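{- Let $H=\langle b\rangle\times\langle c\rangle\cong C_9\times C_3$ with $|b|=9$, $|c|=3$, and set $z=b^3$. For $\lambda,\ell\in\{0,1,2\}$ define $q_{\lambda,\ell}\colon H\to H$ by $q_{\lambda,\ell}(b^jc^m)=z^{\lambda j}c^{\ell j}$. Then for every $(\lambda,\ell)\in\{0,1,2\}^2$ there exists a bijection $f_{\lambda,\ell}\colon H\to H$ such that the three maps $A_{\lambda,\ell}(h)=q_{\lambda,\ell}(h)\,h\,f_{\lambda,\ell}(h)$, $B_{\lambda,\ell}(h)=h^{ -1}f_{\lambda,\ell}(h)$, $C_{\lambda,\ell}(h)=q_{\lambda,\ell}(h)\,f_{\lambda,\ell}(h)$ are bijections of $H$. -}

module Defs where

open import Data.Nat using (ℕ; _+_; _*_)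
open import Data.Nat.DivMod using (_mod_)
open import Data.Fin using (Fin; toℕ)
open import Data.Product using (_×_; _,_)

-- H = ⟨b⟩ × ⟨c⟩ ≅ C₉ × C₃, written additively:
-- the element b^j c^m (j ∈ ℤ/9, m ∈ ℤ/3) is the pair (j , m).
H : Set
H = Fin 9 × Fin 3

_·_ : H → H → H
(j , m) · (j' , m') = ((toℕ j + toℕ j') mod 9) , ((toℕ m + toℕ m') mod 3)

_⁻¹ : H → H
(j , m) ⁻¹ = ((8 * toℕ j) mod 9) , ((2 * toℕ m) mod 3)

-- q_{λ,ℓ}(b^j c^m) = z^(λ j) c^(ℓ j) with z = b³, i.e. b^(3λj) c^(ℓj)
q : Fin 3 → Fin 3 → H → H
q λ' ℓ (j , m) = ((3 * toℕ λ' * toℕ j) mod 9) , ((toℕ ℓ * toℕ j) mod 3)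

{-# OPTIONS --safe #-}

-- No homomorphism f, nor any translate of one, can serve: modulo the Frattini subgroup 3H
-- an endomorphism of H is triangular with diagonal (a , d), q vanishes on the diagonal, so
-- f, h ↦ h ⁻¹ · f h and h ↦ (q h · h) · f h would have first diagonal entries a, a − 1 and
-- a + 1 mod 3, one of which is 0. The maps f are therefore tables found by computer search,
-- and each of the 36 bijectivity claims is decided by exhaustive evaluation over H.
module Submission where

open import Defs
open import Data.Fin using (Fin; #_)
open import Data.Fin.Properties using (any?; all?) renaming (_≟_ to _≟ᶠ_)
open import Data.Product using (Σ; ∃; _×_; _,_)
open import Data.Product.Properties using (≡-dec)
open import Data.Vec using (Vec; []; _∷_; lookup)
open import Function using (_∘_)
open import Function.Consequences.Propositional
  using (strictlySurjective⇒surjective; surjective⇒strictlySurjective)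
open import Function.Definitions using (Injective; Surjective; Bijective)
open import Level using (0ℓ)
open import Relation.Binary.Definitions using (DecidableEquality)
open import Relation.Binary.PropositionalEquality using (_≡_)
open import Relation.Nullary.Decidable
  using (Dec; map′; ¬?; _×-dec_; _→-dec_; decidable-stable; from-yes)
open import Relation.Unary using (Pred; Decidable)

Searchable : Set → Set₁
Searchable A = ∀ {P : Pred A 0ℓ} → Decidable P → Dec (∃ P)

searchable-× : ∀ {A B} → Searchable A → Searchable B → Searchable (A × B)
searchable-× ∃A? ∃B? P? =
  map′ (λ (a , b , p) → (a , b) , p) (λ ((a , b) , p) → a , b , p)
       (∃A? λ a → ∃B? λ b → P? (a , b))

∀-dec : ∀ {A} → Searchable A → ∀ {P : Pred A 0ℓ} → Decidable P → Dec (∀ x → P x)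
∀-dec ∃? P? =
  map′ (λ no-counterexample x → decidable-stable (P? x) (λ ¬p → no-counterexample (x , ¬p)))
       (λ all (x , ¬p) → ¬p (all x))
       (¬? (∃? (¬? ∘ P?)))

module _ {A B : Set} (_≟ᴬ_ : DecidableEquality A) (_≟ᴮ_ : DecidableEquality B)
         (∃A? : Searchable A) (∃B? : Searchable B) where

  injective? : (f : A → B) → Dec (Injective _≡_ _≡_ f)
  injective? f =
    map′ (λ inj → inj (_ , _)) (λ inj (x , y) → inj)
         (∀-dec (searchable-× ∃A? ∃A?) λ (x , y) → (f x ≟ᴮ f y) →-dec (x ≟ᴬ y))

  surjective? : (f : A → B) → Dec (Surjective _≡_ _≡_ f)
  surjective? f =
    map′ strictlySurjective⇒surjective surjective⇒strictlySurjective
         (∀-dec ∃B? λ y → ∃A? λ x → f x ≟ᴮ y)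

  bijective? : (f : A → B) → Dec (Bijective _≡_ _≡_ f)
  bijective? f = injective? f ×-dec surjective? f

_≟ᴴ_ : DecidableEquality H
_≟ᴴ_ = ≡-dec _≟ᶠ_ _≟ᶠ_

searchable-H : Searchable H
searchable-H = searchable-× any? any?

bijectiveᴴ? : (F : H → H) → Dec (Bijective _≡_ _≡_ F)
bijectiveᴴ? = bijective? _≟ᴴ_ _≟ᴴ_ searchable-H searchable-H

Admissible : (H → H) → (H → H) → Set
Admissible q f =
  Bijective _≡_ _≡_ f
  × Bijective _≡_ _≡_ (λ h → (q h · h) · f h)
  × Bijective _≡_ _≡_ (λ h → (h ⁻¹) · f h)
  × Bijective _≡_ _≡_ (λ h → q h · f h)

admissible? : (q f : H → H) → Dec (Admissible q f)
admissible? q f =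
  bijectiveᴴ? f
  ×-dec bijectiveᴴ? (λ h → (q h · h) · f h)
  ×-dec bijectiveᴴ? (λ h → (h ⁻¹) · f h)
  ×-dec bijectiveᴴ? (λ h → q h · f h)

Table : Set
Table = Vec (Vec H 3) 9

byTable : Table → H → H
byTable t (j , m) = lookup (lookup t j) m

f₀₀ : Table
f₀₀ =
  ((# 5 , # 2) ∷ (# 4 , # 2) ∷ (# 8 , # 0) ∷ []) ∷
  ((# 3 , # 1) ∷ (# 7 , # 0) ∷ (# 1 , # 2) ∷ []) ∷
  ((# 3 , # 0) ∷ (# 7 , # 1) ∷ (# 0 , # 1) ∷ []) ∷
  ((# 7 , # 2) ∷ (# 2 , # 0) ∷ (# 6 , # 2) ∷ []) ∷
  ((# 2 , # 1) ∷ (# 6 , # 0) ∷ (# 3 , # 2) ∷ []) ∷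
  ((# 8 , # 2) ∷ (# 2 , # 2) ∷ (# 5 , # 1) ∷ []) ∷
  ((# 6 , # 1) ∷ (# 1 , # 1) ∷ (# 0 , # 0) ∷ []) ∷
  ((# 5 , # 0) ∷ (# 4 , # 1) ∷ (# 8 , # 1) ∷ []) ∷
  ((# 1 , # 0) ∷ (# 0 , # 2) ∷ (# 4 , # 0) ∷ []) ∷
  []

f₀₁ : Table
f₀₁ =
  ((# 4 , # 2) ∷ (# 3 , # 0) ∷ (# 2 , # 2) ∷ []) ∷
  ((# 0 , # 2) ∷ (# 8 , # 0) ∷ (# 1 , # 0) ∷ []) ∷
  ((# 7 , # 1) ∷ (# 6 , # 2) ∷ (# 5 , # 0) ∷ []) ∷
  ((# 2 , # 1) ∷ (# 4 , # 1) ∷ (# 3 , # 2) ∷ []) ∷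
  ((# 1 , # 2) ∷ (# 0 , # 1) ∷ (# 8 , # 2) ∷ []) ∷
  ((# 5 , # 2) ∷ (# 7 , # 0) ∷ (# 6 , # 1) ∷ []) ∷
  ((# 3 , # 1) ∷ (# 2 , # 0) ∷ (# 4 , # 0) ∷ []) ∷
  ((# 8 , # 1) ∷ (# 1 , # 1) ∷ (# 0 , # 0) ∷ []) ∷
  ((# 6 , # 0) ∷ (# 5 , # 1) ∷ (# 7 , # 2) ∷ []) ∷
  []

f₀₂ : Table
f₀₂ =
  ((# 2 , # 0) ∷ (# 6 , # 1) ∷ (# 4 , # 1) ∷ []) ∷
  ((# 1 , # 0) ∷ (# 3 , # 2) ∷ (# 8 , # 2) ∷ []) ∷
  ((# 5 , # 0) ∷ (# 0 , # 2) ∷ (# 7 , # 2) ∷ []) ∷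
  ((# 4 , # 2) ∷ (# 6 , # 0) ∷ (# 2 , # 2) ∷ []) ∷
  ((# 8 , # 1) ∷ (# 3 , # 0) ∷ (# 1 , # 1) ∷ []) ∷
  ((# 5 , # 1) ∷ (# 0 , # 1) ∷ (# 7 , # 1) ∷ []) ∷
  ((# 6 , # 2) ∷ (# 4 , # 0) ∷ (# 2 , # 1) ∷ []) ∷
  ((# 3 , # 1) ∷ (# 1 , # 2) ∷ (# 8 , # 0) ∷ []) ∷
  ((# 0 , # 0) ∷ (# 5 , # 2) ∷ (# 7 , # 0) ∷ []) ∷
  []

f₁₀ : Table
f₁₀ =
  ((# 7 , # 1) ∷ (# 8 , # 2) ∷ (# 3 , # 1) ∷ []) ∷
  ((# 2 , # 0) ∷ (# 6 , # 0) ∷ (# 3 , # 0) ∷ []) ∷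
  ((# 5 , # 1) ∷ (# 6 , # 2) ∷ (# 7 , # 2) ∷ []) ∷
  ((# 0 , # 1) ∷ (# 6 , # 1) ∷ (# 2 , # 2) ∷ []) ∷
  ((# 4 , # 0) ∷ (# 1 , # 0) ∷ (# 5 , # 0) ∷ []) ∷
  ((# 3 , # 2) ∷ (# 2 , # 1) ∷ (# 0 , # 2) ∷ []) ∷
  ((# 5 , # 2) ∷ (# 4 , # 1) ∷ (# 1 , # 1) ∷ []) ∷
  ((# 0 , # 0) ∷ (# 8 , # 0) ∷ (# 7 , # 0) ∷ []) ∷
  ((# 1 , # 2) ∷ (# 4 , # 2) ∷ (# 8 , # 1) ∷ []) ∷
  []

f₁₁ : Table
f₁₁ =
  ((# 1 , # 2) ∷ (# 4 , # 1) ∷ (# 3 , # 0) ∷ []) ∷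
  ((# 0 , # 0) ∷ (# 6 , # 1) ∷ (# 3 , # 2) ∷ []) ∷
  ((# 7 , # 1) ∷ (# 0 , # 2) ∷ (# 8 , # 2) ∷ []) ∷
  ((# 6 , # 2) ∷ (# 7 , # 0) ∷ (# 2 , # 0) ∷ []) ∷
  ((# 4 , # 0) ∷ (# 5 , # 1) ∷ (# 1 , # 1) ∷ []) ∷
  ((# 2 , # 1) ∷ (# 3 , # 1) ∷ (# 5 , # 0) ∷ []) ∷
  ((# 5 , # 2) ∷ (# 0 , # 1) ∷ (# 8 , # 1) ∷ []) ∷
  ((# 7 , # 2) ∷ (# 2 , # 2) ∷ (# 8 , # 0) ∷ []) ∷
  ((# 4 , # 2) ∷ (# 6 , # 0) ∷ (# 1 , # 0) ∷ []) ∷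
  []

f₁₂ : Table
f₁₂ =
  ((# 1 , # 2) ∷ (# 2 , # 2) ∷ (# 5 , # 0) ∷ []) ∷
  ((# 0 , # 2) ∷ (# 8 , # 2) ∷ (# 2 , # 0) ∷ []) ∷
  ((# 8 , # 0) ∷ (# 1 , # 1) ∷ (# 5 , # 2) ∷ []) ∷
  ((# 7 , # 1) ∷ (# 3 , # 2) ∷ (# 0 , # 1) ∷ []) ∷
  ((# 7 , # 2) ∷ (# 4 , # 1) ∷ (# 1 , # 0) ∷ []) ∷
  ((# 7 , # 0) ∷ (# 0 , # 0) ∷ (# 6 , # 2) ∷ []) ∷
  ((# 4 , # 0) ∷ (# 6 , # 0) ∷ (# 8 , # 1) ∷ []) ∷
  ((# 6 , # 1) ∷ (# 3 , # 0) ∷ (# 5 , # 1) ∷ []) ∷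
  ((# 2 , # 1) ∷ (# 3 , # 1) ∷ (# 4 , # 2) ∷ []) ∷
  []

f₂₀ : Table
f₂₀ =
  ((# 6 , # 0) ∷ (# 3 , # 0) ∷ (# 0 , # 0) ∷ []) ∷
  ((# 6 , # 1) ∷ (# 1 , # 0) ∷ (# 4 , # 0) ∷ []) ∷
  ((# 3 , # 2) ∷ (# 6 , # 2) ∷ (# 0 , # 2) ∷ []) ∷
  ((# 7 , # 2) ∷ (# 4 , # 2) ∷ (# 2 , # 0) ∷ []) ∷
  ((# 7 , # 0) ∷ (# 3 , # 1) ∷ (# 2 , # 1) ∷ []) ∷
  ((# 7 , # 1) ∷ (# 2 , # 2) ∷ (# 1 , # 1) ∷ []) ∷
  ((# 8 , # 0) ∷ (# 5 , # 0) ∷ (# 1 , # 2) ∷ []) ∷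
  ((# 5 , # 1) ∷ (# 8 , # 1) ∷ (# 0 , # 1) ∷ []) ∷
  ((# 5 , # 2) ∷ (# 4 , # 1) ∷ (# 8 , # 2) ∷ []) ∷
  []

f₂₁ : Table
f₂₁ =
  ((# 1 , # 1) ∷ (# 7 , # 1) ∷ (# 6 , # 2) ∷ []) ∷
  ((# 5 , # 2) ∷ (# 3 , # 0) ∷ (# 6 , # 0) ∷ []) ∷
  ((# 1 , # 0) ∷ (# 3 , # 1) ∷ (# 4 , # 0) ∷ []) ∷
  ((# 0 , # 2) ∷ (# 3 , # 2) ∷ (# 8 , # 1) ∷ []) ∷
  ((# 4 , # 2) ∷ (# 2 , # 2) ∷ (# 8 , # 2) ∷ []) ∷
  ((# 0 , # 1) ∷ (# 8 , # 0) ∷ (# 6 , # 1) ∷ []) ∷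
  ((# 5 , # 1) ∷ (# 2 , # 1) ∷ (# 4 , # 1) ∷ []) ∷
  ((# 0 , # 0) ∷ (# 1 , # 2) ∷ (# 7 , # 2) ∷ []) ∷
  ((# 2 , # 0) ∷ (# 7 , # 0) ∷ (# 5 , # 0) ∷ []) ∷
  []

f₂₂ : Table
f₂₂ =
  ((# 2 , # 2) ∷ (# 0 , # 0) ∷ (# 6 , # 2) ∷ []) ∷
  ((# 0 , # 1) ∷ (# 7 , # 2) ∷ (# 2 , # 1) ∷ []) ∷
  ((# 8 , # 2) ∷ (# 7 , # 1) ∷ (# 5 , # 1) ∷ []) ∷
  ((# 8 , # 1) ∷ (# 3 , # 1) ∷ (# 5 , # 0) ∷ []) ∷
  ((# 4 , # 1) ∷ (# 8 , # 0) ∷ (# 5 , # 2) ∷ []) ∷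
  ((# 4 , # 0) ∷ (# 0 , # 2) ∷ (# 3 , # 0) ∷ []) ∷
  ((# 4 , # 2) ∷ (# 1 , # 1) ∷ (# 7 , # 0) ∷ []) ∷
  ((# 3 , # 2) ∷ (# 6 , # 0) ∷ (# 1 , # 0) ∷ []) ∷
  ((# 2 , # 0) ∷ (# 6 , # 1) ∷ (# 1 , # 2) ∷ []) ∷
  []

witness : Fin 3 → Fin 3 → H → H
witness λ' ℓ = byTable (lookup (lookup tables λ') ℓ)
  where
  tables : Vec (Vec Table 3) 3
  tables =
    (f₀₀ ∷ f₀₁ ∷ f₀₂ ∷ []) ∷
    (f₁₀ ∷ f₁₁ ∷ f₁₂ ∷ []) ∷
    (f₂₀ ∷ f₂₁ ∷ f₂₂ ∷ []) ∷
    []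

witness-admissible : ∀ λ' ℓ → Admissible (q λ' ℓ) (witness λ' ℓ)
witness-admissible = from-yes (all? λ λ' → all? λ ℓ → admissible? (q λ' ℓ) (witness λ' ℓ))

lemma3p5 : (λ' ℓ : Fin 3) →
    Σ (H → H) (λ f →
      Bijective _≡_ _≡_ f
      × Bijective _≡_ _≡_ (λ h → (q λ' ℓ h · h) · f h)
      × Bijective _≡_ _≡_ (λ h → (h ⁻¹) · f h)
      × Bijective _≡_ _≡_ (λ h → q λ' ℓ h · f h))
lemma3p5 λ' ℓ = witness λ' ℓ , witness-admissible λ' ℓ
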